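{- Let $p,r,k$ be positive integers and let $X=X_1UX_2$ and $Y=Y_1VY_2$ be strings such that: (i) $|X_1|=|Y_1|$, $|X_2|=|Y_2|$, and $|U|=|V|=rp$ with $r\ge 2k+1$; (ii) $U\approx V$; (iii) there is no position $i\in[1,|Y_1|]$ with $\mathsf{nsv}_Y(i)\in[|Y_1|+p+1,|Y_1V|]$; (iv) with $c_i:=|X_1|+ip$ for $i\in[1,r]$, $X[c_i]$ is the leftmost minimum of $X(c_1-p\mathinner{.\,.} c_i]$ and $Y[c_i]$ is the leftmost minimum of $Y(c_1-p\mathinner{.\,.} c_i]$ for every $i\in[1,r]$; (v) $\mathsf{CHd}(X\leadsto Y)\le k$. Then any sequence of $\mathsf{CHd}(X\leadsto Y)$ substitutions that transforms $X$ into a string $X'$ with $X'\approx Y$ performs no substitution in the fragment $X[c_{k+1}\mathinner{.\,.} c_{r-k}]$.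
   Context: Strings are over a totally ordered alphabet; $X[i]$ is the $i$-th character (1-indexed), $X[i\mathinner{.\,.} j]$ denotes $X[i]\cdots X[j]$ and $X(i\mathinner{.\,.} j]$ denotes $X[i+1]\cdots X[j]$; juxtaposition denotes concatenation. The leftmost minimum of a nonempty string $S$ is $S[t]$ for the smallest index $t$ at which the minimum value occurs. The Cartesian tree $\mathsf{CT}(S)$: empty for the empty string; otherwise a root with left subtree $\mathsf{CT}(S[1\mathinner{.\,.} t-1])$ and right subtree $\mathsf{CT}(S[t+1\mathinner{.\,.} |S|])$, where $S[t]$ is the leftmost minimum. $S\approx S'$ iff $\mathsf{CT}(S)=\mathsf{CT}(S')$. For a string $Y$, $\mathsf{nsv}_Y(i)=\min(\{j\in(i,|Y|]: Y[j]<Y[i]\}\cup\{|Y|+1\})$. For equal-length strings $X,Y$, $\mathsf{CHd}(X\leadsto Y)$ is the minimum number of character substitutions needed to transform $X$ into a string $X'$ with $X'\approx Y$. -}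

module Defs where

open import Level using (Level)
open import Data.Nat using (ℕ; zero; suc; _+_; _*_; _∸_; _≤_)
open import Data.Product using (_×_; _,_; proj₁; proj₂; ∃)
open import Data.List using (List; []; _∷_; length; take; drop; foldl)
open import Data.List.Relation.Unary.All using (All)
open import Relation.Nullary using (yes; no)
open import Relation.Binary.Bundles using (StrictTotalOrder)
open import Relation.Binary.PropositionalEquality using (_≡_)

-- Shape of a Cartesian tree (unlabelled binary tree).
data Tree : Set where
  leaf : Tree
  node : Tree → Tree → Tree

module Strings {c ℓ₁ ℓ₂ : Level} (O : StrictTotalOrder c ℓ₁ ℓ₂) where
  open StrictTotalOrder O using (Carrier; _<_; _<?_)

  Str : Set c
  Str = List Carrier

  -- lmin x xs = (0-based index, value) of the leftmost minimum of x ∷ xs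
  lmin : Carrier → Str → ℕ × Carrier
  lmin x [] = 0 , x
  lmin x (y ∷ ys) with lmin y ys
  ... | j , m with m <? x
  ...   | yes _ = suc j , m
  ...   | no  _ = 0 , x

  -- 1-based position of the leftmost minimum of a nonempty string (0 for the empty string)
  lminPos : Str → ℕ
  lminPos [] = 0
  lminPos (x ∷ xs) = suc (proj₁ (lmin x xs))

  -- Cartesian tree, by recursion with fuel (fuel = length suffices)
  CT′ : ℕ → Str → Tree
  CT′ _ [] = leaf
  CT′ zero (_ ∷ _) = leaf
  CT′ (suc f) (x ∷ xs) =
    node (CT′ f (take t (x ∷ xs))) (CT′ f (drop (suc t) (x ∷ xs)))
    where t = proj₁ (lmin x xs)

  CT : Str → Tree
  CT S = CT′ (length S) S

  _≈CT_ : Str → Str → Set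
  S ≈CT S′ = CT S ≡ CT S′

  -- firstLess y zs: offset (1-based) of the first element of zs smaller than y,
  -- or length zs + 1 if none
  firstLess : Carrier → Str → ℕ
  firstLess y [] = 1
  firstLess y (z ∷ zs) with z <? y
  ... | yes _ = 1
  ... | no  _ = suc (firstLess y zs)

  -- nsv_Y(i), for 1 ≤ i ≤ |Y| (value |Y|+1 outside that range)
  nsv : Str → ℕ → ℕ
  nsv Y i with drop (i ∸ 1) Y
  ... | [] = suc (length Y)
  ... | y ∷ rest = i + firstLess y rest

  -- the fragment S(a .. b]
  frag : Str → ℕ → ℕ → Str
  frag S a b = take (b ∸ a) (drop a S)

  -- S[t] is the leftmost minimum of S(a .. b]  (t absolute, 1-based)
  LeftmostMinAt : Str → ℕ → ℕ → ℕ → Set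
  LeftmostMinAt S a b t = a + lminPos (frag S a b) ≡ t

  -- substitution of the character at 1-based position j by a
  set : Str → ℕ → Carrier → Str
  set [] j a = []
  set (x ∷ xs) zero a = x ∷ xs
  set (x ∷ xs) (suc zero) a = a ∷ xs
  set (x ∷ xs) (suc (suc j)) a = x ∷ set xs (suc j) a

  -- a substitution: (1-based position, new character)
  Subst : Set c
  Subst = ℕ × Carrier

  apply : Str → List Subst → Str
  apply X ss = foldl (λ Z s → set Z (proj₁ s) (proj₂ s)) X ss

  ValidSubs : Str → List Subst → Set c
  ValidSubs X ss = All (λ s → 1 ≤ proj₁ s × proj₁ s ≤ length X) ss

  Transforms : Str → Str → List Subst → Set c
  Transforms X Y ss = ValidSubs X ss × (apply X ss ≈CT Y)

  IsCHd : Str → Str → ℕ → Set c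
  IsCHd X Y d =
    (∃ λ ss → Transforms X Y ss × length ss ≡ d) ×
    (∀ ss → Transforms X Y ss → d ≤ length ss)

{-# OPTIONS --safe #-}
module Submission where

-- Suppose a minimum-length transformation ss substitutes at a position q of the core [c (k+1), c (r-k)].
-- As ss has at most k substitutions, pigeonhole yields anchors c i (i ≤ k) and c j (j > r-k) untouched by ss,
-- with c i < q ≤ c j. Dropping the substitutions inside the block (c i, c j] gives a shorter list whose result
-- agrees with X on the block and with X′ = apply X ss elsewhere, and it is still ≈ Y. Cartesian-tree
-- equivalence can be tested interval by interval, by asking whether the leftmost minimum sits at an endpoint:
-- intervals inside the block are settled by U ≈ V, intervals avoiding it by X′ ≈ Y, and intervals crossing
-- an anchor by the anchors being prefix minima of the U-region (iv), with the nsv condition (iii) handling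
-- intervals that start before U. This contradicts minimality.

open import Level using (Level)
open import Function using (_∘_; _⇔_; mk⇔; Equivalence)
open import Function.Properties.Equivalence using () renaming (trans to ⇔-trans; sym to ⇔-sym)
open import Data.Nat using (ℕ; zero; suc; _+_; _*_; _∸_; _≤_; _<_; z≤n; s≤s; _≤?_; _<?_; _≟_; NonZero; >-nonZero)
open import Data.Nat.Properties
open import Data.Product using (_×_; _,_; proj₁; proj₂; ∃)
open import Data.Sum using (inj₁; inj₂)
open import Data.List using (List; []; _∷_; length; take; drop; _++_; map; foldl; filter)
open import Data.List.Properties using (length-take; length-drop; length-++; length-map; filter-notAll)
open import Data.List.Membership.Propositional using (_∈_; _∉_)
open import Data.List.Membership.Propositional.Properties using (∈-filter⁺; ∈-map⁺)
import Data.List.Relation.Unary.Any as Any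
open import Data.List.Relation.Unary.Any using (here; there)
open import Data.List.Relation.Unary.All as All using (All)
open import Data.List.Relation.Unary.All.Properties using (filter⁺)
open import Relation.Nullary using (¬_; yes; no; contradiction)
open import Relation.Nullary.Decidable using (_×-dec_; ¬?)
open import Relation.Unary using (Decidable)
open import Relation.Binary.Bundles using (StrictTotalOrder)
open import Relation.Binary.Definitions using (tri<; tri≈; tri>)
open import Relation.Binary.PropositionalEquality
  using (_≡_; _≢_; ≢-sym; refl; sym; trans; cong; cong₂; subst; subst₂; module ≡-Reasoning)

open import Defs

open Equivalence using (to; from)

¬×¬⇒⇔ : ∀ {p q} {P : Set p} {Q : Set q} → ¬ P → ¬ Q → P ⇔ Q
¬×¬⇒⇔ ¬p ¬q = mk⇔ (λ p → contradiction p ¬p) (λ q → contradiction q ¬q)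

size : Tree → ℕ
size leaf = 0
size (node l r) = suc (size l + size r)

left right : Tree → Tree
left leaf = leaf
left (node l _) = l
right leaf = leaf
right (node _ r) = r

InBlock : ℕ → ℕ → ℕ → Set
InBlock ci cj z = ci < z × z ≤ cj

inBlock? : ∀ ci cj → Decidable (InBlock ci cj)
inBlock? ci cj z = (ci <? z) ×-dec (z ≤? cj)

outsideBlock? : ∀ ci cj → Decidable (λ z → ¬ InBlock ci cj z)
outsideBlock? ci cj z = ¬? (inBlock? ci cj z)

length-take-≤ : ∀ {a} {A : Set a} t (xs : List A) → t ≤ length xs → length (take t xs) ≡ t
length-take-≤ t xs t≤ = trans (length-take t xs) (m≤n⇒m⊓n≡m t≤)

length-infix-≤ : ∀ {a} {A : Set a} (xs ys zs : List A) → length xs + length ys ≤ length (xs ++ ys ++ zs)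
length-infix-≤ xs ys zs = subst (length xs + length ys ≤_) (sym (trans (length-++ xs) (cong (length xs +_) (length-++ ys))))
                                (+-monoʳ-≤ (length xs) (m≤m+n _ _))

pigeonhole-∉ : ∀ (f : ℕ → ℕ) k {q} (ps : List ℕ) → length ps ≤ k → q ∈ ps →
               (∀ i → 1 ≤ i → i ≤ k → f i ≢ q) →
               (∀ i j → f i ≡ f j → i ≡ j) → ∃ λ i → 1 ≤ i × i ≤ k × f i ∉ ps
pigeonhole-∉ f zero [] _ () _ _
pigeonhole-∉ f (suc k) {q} ps |ps|≤ q∈ps f≢q f-inj with Any.any? (f (suc k) ≟_) ps
... | no fk∉ps = suc k , s≤s z≤n , ≤-refl , fk∉ps
... | yes fk∈ps =
  let i , 1≤i , i≤k , fi∉ps′ =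
        pigeonhole-∉ f k ps′ |ps′|≤k q∈ps′ (λ i 1≤i i≤k → f≢q i 1≤i (m≤n⇒m≤1+n i≤k)) f-inj
  in i , 1≤i , m≤n⇒m≤1+n i≤k ,
     λ fi∈ps → fi∉ps′ (∈-filter⁺ ≢fk? fi∈ps (λ fi≡fk → <⇒≢ (s≤s i≤k) (f-inj i (suc k) fi≡fk)))
  where
    ≢fk? : Decidable (_≢ f (suc k))
    ≢fk? p = ¬? (p ≟ f (suc k))
    ps′ : List ℕ
    ps′ = filter ≢fk? ps
    |ps′|≤k : length ps′ ≤ k
    |ps′|≤k = ≤-pred (≤-trans (filter-notAll ≢fk? ps (Any.map (λ fk≡p p≢fk → p≢fk (sym fk≡p)) fk∈ps)) |ps|≤)
    q∈ps′ : q ∈ ps′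
    q∈ps′ = ∈-filter⁺ ≢fk? q∈ps (λ q≡fk → f≢q (suc k) (s≤s z≤n) ≤-refl (sym q≡fk))

module Anchors (A p : ℕ) (1≤p : 1 ≤ p) where
  instance
    p≢0 : NonZero p
    p≢0 = >-nonZero 1≤p

  c : ℕ → ℕ
  c i = A + i * p

  c-strictMono : ∀ {i j} → i < j → c i < c j
  c-strictMono i<j = +-monoʳ-< A (*-monoˡ-< p i<j)

  c-mono : ∀ {i j} → i ≤ j → c i ≤ c j
  c-mono i≤j = +-monoʳ-≤ A (*-monoˡ-≤ p i≤j)

  c-injective : ∀ i j → c i ≡ c j → i ≡ j
  c-injective i j ci≡cj = *-cancelʳ-≡ i j p (+-cancelˡ-≡ A _ _ ci≡cj)

  A+p≤c : ∀ {i} → 1 ≤ i → A + p ≤ c i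
  A+p≤c {i} 1≤i = +-monoʳ-≤ A (subst (_≤ i * p) (*-identityˡ p) (*-monoˡ-≤ p 1≤i))

  A<c : ∀ {i} → 1 ≤ i → A < c i
  A<c 1≤i = <-≤-trans (m<m+n A 1≤p) (A+p≤c 1≤i)

  c1∸p≡A : c 1 ∸ p ≡ A
  c1∸p≡A = trans (cong (λ u → A + u ∸ p) (*-identityˡ p)) (m+n∸n≡m A p)

  anchor-∉-below : ∀ k {q} ps → length ps ≤ k → q ∈ ps → c (k + 1) ≤ q →
                   ∃ λ i → 1 ≤ i × i ≤ k × c i < q × c i ∉ ps
  anchor-∉-below k {q} ps |ps|≤k q∈ps c[k+1]≤q =
    let i , 1≤i , i≤k , ci∉ps = pigeonhole-∉ c k ps |ps|≤k q∈ps (λ i _ i≤k → <⇒≢ (ci<q i≤k)) c-injective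
    in i , 1≤i , i≤k , ci<q i≤k , ci∉ps
    where
      ci<q : ∀ {i} → i ≤ k → c i < q
      ci<q i≤k = <-≤-trans (c-strictMono (≤-<-trans i≤k (m<m+n k (s≤s z≤n)))) c[k+1]≤q

  anchor-∉-above : ∀ o k {q} ps → length ps ≤ k → q ∈ ps → q ≤ c o →
                   ∃ λ i → 1 ≤ i × i ≤ k × q < c (o + i) × c (o + i) ∉ ps
  anchor-∉-above o k {q} ps |ps|≤k q∈ps q≤co =
    let i , 1≤i , i≤k , ci∉ps = pigeonhole-∉ (c ∘ (o +_)) k ps |ps|≤k q∈ps (λ i 1≤i _ → ≢-sym (<⇒≢ (q<c 1≤i)))
                                  (λ i j e → +-cancelˡ-≡ o i j (c-injective _ _ e))
    in i , 1≤i , i≤k , q<c 1≤i , ci∉ps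
    where
      q<c : ∀ {i} → 1 ≤ i → q < c (o + i)
      q<c 1≤i = ≤-<-trans q≤co (c-strictMono (m<m+n o 1≤i))

module Sequences {c ℓ₁ ℓ₂ : Level} (O : StrictTotalOrder c ℓ₁ ℓ₂) where
  open StrictTotalOrder O using (Carrier; compare; module Eq; <-respʳ-≈; <-respˡ-≈; asym; irrefl)
    renaming (_<_ to _⊏_; trans to ⊏-trans; _<?_ to _⊏?_)

  ⊏-irrefl : ∀ {u} → ¬ (u ⊏ u)
  ⊏-irrefl = irrefl Eq.refl

  ≮-trans : ∀ {u v w} → ¬ (u ⊏ v) → ¬ (v ⊏ w) → ¬ (u ⊏ w)
  ≮-trans {u} {v} {w} u≮v v≮w u<w with compare v w
  ... | tri< v<w _ _ = v≮w v<w
  ... | tri≈ _ v≈w _ = u≮v (<-respʳ-≈ (Eq.sym v≈w) u<w)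
  ... | tri> _ _ w<v = u≮v (⊏-trans u<w w<v)

  <-≮-trans : ∀ {u v w} → u ⊏ v → ¬ (w ⊏ v) → u ⊏ w
  <-≮-trans {u} {v} {w} u<v w≮v with compare v w
  ... | tri< v<w _ _ = ⊏-trans u<v v<w
  ... | tri≈ _ v≈w _ = <-respʳ-≈ v≈w u<v
  ... | tri> _ _ w<v = contradiction w<v w≮v

  ≮-<-trans : ∀ {u v w} → ¬ (v ⊏ u) → v ⊏ w → u ⊏ w
  ≮-<-trans {u} {v} {w} v≮u v<w with compare u v
  ... | tri< u<v _ _ = ⊏-trans u<v v<w
  ... | tri≈ _ u≈v _ = <-respˡ-≈ (Eq.sym u≈v) v<w
  ... | tri> _ _ v<u = contradiction v<u v≮u

  Seq : Set c
  Seq = ℕ → Carrier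

  LminAtStart LminAtEnd : Seq → ℕ → ℕ → Set ℓ₂
  LminAtStart f a b = ∀ z → a < z → z ≤ b → ¬ (f z ⊏ f a)
  LminAtEnd f a b = ∀ z → a ≤ z → z < b → f b ⊏ f z

  record LminAt (f : Seq) (lo hi m : ℕ) : Set ℓ₂ where
    field
      lo≤m : lo ≤ m
      m≤hi : m ≤ hi
      end : LminAtEnd f lo m
      start : LminAtStart f m hi

  AgreeOn : Seq → Seq → ℕ → ℕ → Set c
  AgreeOn f h a b = ∀ z → a ≤ z → z ≤ b → f z ≡ h z

  SameEndMinima : Seq → Seq → ℕ → ℕ → Set ℓ₂
  SameEndMinima f h a b = (LminAtStart f a b ⇔ LminAtStart h a b) × (LminAtEnd f a b ⇔ LminAtEnd h a b)

  -- f[lo..hi] and h[lo..hi] have the same Cartesian tree iff on every subinterval they agree on whether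
  -- the leftmost minimum sits at the left end and whether it sits at the right end (≈CT⇒CTEquivOn, CTEquivOn⇒≈CT).
  CTEquivOn : Seq → Seq → ℕ → ℕ → Set ℓ₂
  CTEquivOn f h lo hi = ∀ a b → lo ≤ a → a ≤ b → b ≤ hi → SameEndMinima f h a b

  AgreeOn-sym : ∀ {f h a b} → AgreeOn f h a b → AgreeOn h f a b
  AgreeOn-sym f≗h z a≤z z≤b = sym (f≗h z a≤z z≤b)

  LminAtStart-cong : ∀ {f h a b} → a ≤ b → AgreeOn f h a b → LminAtStart f a b → LminAtStart h a b
  LminAtStart-cong {f} {h} a≤b f≗h L z a<z z≤b hz<ha =
    L z a<z z≤b (subst₂ _⊏_ (sym (f≗h z (<⇒≤ a<z) z≤b)) (sym (f≗h _ ≤-refl a≤b)) hz<ha)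

  LminAtEnd-cong : ∀ {f h a b} → a ≤ b → AgreeOn f h a b → LminAtEnd f a b → LminAtEnd h a b
  LminAtEnd-cong a≤b f≗h R z a≤z z<b = subst₂ _⊏_ (f≗h _ a≤b ≤-refl) (f≗h z a≤z (<⇒≤ z<b)) (R z a≤z z<b)

  AgreeOn⇒SameEndMinima : ∀ {f h a b} → a ≤ b → AgreeOn f h a b → SameEndMinima f h a b
  AgreeOn⇒SameEndMinima a≤b f≗h =
    mk⇔ (LminAtStart-cong a≤b f≗h) (LminAtStart-cong a≤b (AgreeOn-sym f≗h)) ,
    mk⇔ (LminAtEnd-cong a≤b f≗h) (LminAtEnd-cong a≤b (AgreeOn-sym f≗h))

  SameEndMinima-trans : ∀ {f g h a b} → SameEndMinima f g a b → SameEndMinima g h a b → SameEndMinima f h a b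
  SameEndMinima-trans (L₁ , R₁) (L₂ , R₂) = ⇔-trans L₁ L₂ , ⇔-trans R₁ R₂

  LminAtStart-shrink : ∀ {f a b b′} → b′ ≤ b → LminAtStart f a b → LminAtStart f a b′
  LminAtStart-shrink b′≤b L z a<z z≤b′ = L z a<z (≤-trans z≤b′ b′≤b)

  LminAtEnd-shrink : ∀ {f a a′ b} → a ≤ a′ → LminAtEnd f a b → LminAtEnd f a′ b
  LminAtEnd-shrink a≤a′ R z a′≤z z<b = R z (≤-trans a≤a′ a′≤z) z<b

  LminAtEnd-below : ∀ {f a b z} → LminAtEnd f a b → a ≤ z → z ≤ b → ¬ (f z ⊏ f b)
  LminAtEnd-below {b = b} {z} R a≤z z≤b with m≤n⇒m<n∨m≡n z≤b
  ... | inj₁ z<b = asym (R z a≤z z<b)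
  ... | inj₂ refl = ⊏-irrefl

  LminAtEnd-join : ∀ {f a m b} → a ≤ m → m < b → LminAtEnd f a m → LminAtEnd f m b → LminAtEnd f a b
  LminAtEnd-join {m = m} a≤m m<b R₁ R₂ z a≤z z<b with m ≤? z
  ... | yes m≤z = R₂ z m≤z z<b
  ... | no m≰z = ⊏-trans (R₂ m ≤-refl m<b) (R₁ z a≤z (≰⇒> m≰z))

  CTEquivOn-cong : ∀ {f f′ h h′ lo hi} → AgreeOn f f′ lo hi → AgreeOn h h′ lo hi →
                   CTEquivOn f h lo hi → CTEquivOn f′ h′ lo hi
  CTEquivOn-cong {lo = lo} {hi} f≗f′ h≗h′ E a b lo≤a a≤b b≤hi =
    SameEndMinima-trans (AgreeOn⇒SameEndMinima a≤b (restrict (AgreeOn-sym f≗f′)))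
      (SameEndMinima-trans (E a b lo≤a a≤b b≤hi) (AgreeOn⇒SameEndMinima a≤b (restrict h≗h′)))
    where
      restrict : ∀ {u v} → AgreeOn u v lo hi → AgreeOn u v a b
      restrict u≗v z a≤z z≤b = u≗v z (≤-trans lo≤a a≤z) (≤-trans z≤b b≤hi)

  CTEquivOn-shrink : ∀ {f h lo hi lo′ hi′} → lo ≤ lo′ → hi′ ≤ hi → CTEquivOn f h lo hi → CTEquivOn f h lo′ hi′
  CTEquivOn-shrink lo≤lo′ hi′≤hi E a b lo′≤a a≤b b≤hi′ =
    E a b (≤-trans lo≤lo′ lo′≤a) a≤b (≤-trans b≤hi′ hi′≤hi)

  LminAtStart-shift : ∀ f k {a b} → LminAtStart (f ∘ (k +_)) a b ⇔ LminAtStart f (k + a) (k + b)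
  LminAtStart-shift f k {a} {b} = mk⇔ shift unshift
    where
      shift : LminAtStart (f ∘ (k +_)) a b → LminAtStart f (k + a) (k + b)
      shift L z k+a<z z≤k+b with m≤n⇒∃[o]m+o≡n (≤-trans (m≤m+n k a) (<⇒≤ k+a<z))
      ... | z′ , refl = L z′ (+-cancelˡ-< k a z′ k+a<z) (+-cancelˡ-≤ k z′ b z≤k+b)
      unshift : LminAtStart f (k + a) (k + b) → LminAtStart (f ∘ (k +_)) a b
      unshift L z a<z z≤b = L (k + z) (+-monoʳ-< k a<z) (+-monoʳ-≤ k z≤b)

  LminAtEnd-shift : ∀ f k {a b} → LminAtEnd (f ∘ (k +_)) a b ⇔ LminAtEnd f (k + a) (k + b)
  LminAtEnd-shift f k {a} {b} = mk⇔ shift unshift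
    where
      shift : LminAtEnd (f ∘ (k +_)) a b → LminAtEnd f (k + a) (k + b)
      shift R z k+a≤z z<k+b with m≤n⇒∃[o]m+o≡n (≤-trans (m≤m+n k a) k+a≤z)
      ... | z′ , refl = R z′ (+-cancelˡ-≤ k a z′ k+a≤z) (+-cancelˡ-< k z′ b z<k+b)
      unshift : LminAtEnd f (k + a) (k + b) → LminAtEnd (f ∘ (k +_)) a b
      unshift R z a≤z z<b = R (k + z) (+-monoʳ-≤ k a≤z) (+-monoʳ-< k z<b)

  SameEndMinima-shift : ∀ f h k {a b} → SameEndMinima (f ∘ (k +_)) (h ∘ (k +_)) a b ⇔ SameEndMinima f h (k + a) (k + b)
  SameEndMinima-shift f h k = mk⇔
    (λ (L , R) → ⇔-trans (⇔-sym (LminAtStart-shift f k)) (⇔-trans L (LminAtStart-shift h k)) ,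
                 ⇔-trans (⇔-sym (LminAtEnd-shift f k)) (⇔-trans R (LminAtEnd-shift h k)))
    (λ (L , R) → ⇔-trans (LminAtStart-shift f k) (⇔-trans L (⇔-sym (LminAtStart-shift h k))) ,
                 ⇔-trans (LminAtEnd-shift f k) (⇔-trans R (⇔-sym (LminAtEnd-shift h k))))

  CTEquivOn-shift : ∀ f h k {lo hi} → CTEquivOn (f ∘ (k +_)) (h ∘ (k +_)) lo hi → CTEquivOn f h (k + lo) (k + hi)
  CTEquivOn-shift f h k {lo} {hi} E a b k+lo≤a a≤b b≤k+hi
    with m≤n⇒∃[o]m+o≡n (≤-trans (m≤m+n k lo) k+lo≤a)
       | m≤n⇒∃[o]m+o≡n (≤-trans (m≤m+n k lo) (≤-trans k+lo≤a a≤b))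
  ... | a′ , refl | b′ , refl =
    to (SameEndMinima-shift f h k)
       (E a′ b′ (+-cancelˡ-≤ k lo a′ k+lo≤a) (+-cancelˡ-≤ k a′ b′ a≤b) (+-cancelˡ-≤ k b′ hi b≤k+hi))

  CTEquivOn-unshift : ∀ f h k {lo hi} → CTEquivOn f h (k + lo) (k + hi) → CTEquivOn (f ∘ (k +_)) (h ∘ (k +_)) lo hi
  CTEquivOn-unshift f h k E a b lo≤a a≤b b≤hi =
    from (SameEndMinima-shift f h k) (E (k + a) (k + b) (+-monoʳ-≤ k lo≤a) (+-monoʳ-≤ k a≤b) (+-monoʳ-≤ k b≤hi))

  LminAt-refl : ∀ {f m} → LminAt f m m m
  LminAt-refl = record
    { lo≤m = ≤-refl ; m≤hi = ≤-refl
    ; end = λ z m≤z z<m → contradiction z<m (≤⇒≯ m≤z)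
    ; start = λ z m<z z≤m → contradiction z≤m (<⇒≱ m<z) }

  LminAt-below : ∀ {f lo hi m z} → LminAt f lo hi m → lo ≤ z → z ≤ hi → ¬ (f z ⊏ f m)
  LminAt-below {m = m} {z} M lo≤z z≤hi with <-cmp z m
  ... | tri< z<m _ _ = asym (LminAt.end M z lo≤z z<m)
  ... | tri≈ _ refl _ = ⊏-irrefl
  ... | tri> _ _ m<z = LminAt.start M z m<z z≤hi

  lmin-exists : ∀ f {lo} hi → lo ≤ hi → ∃ (LminAt f lo hi)
  lmin-exists f zero z≤n = 0 , LminAt-refl
  lmin-exists f {lo} (suc h) lo≤h+1 with lo ≟ suc h
  ... | yes refl = suc h , LminAt-refl
  ... | no lo≢h+1 with lmin-exists f h (≤-pred (≤∧≢⇒< lo≤h+1 lo≢h+1))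
  ...   | m , M with f (suc h) ⊏? f m
  ...     | yes h+1<m = suc h , record
            { lo≤m = lo≤h+1 ; m≤hi = ≤-refl
            ; end = λ z lo≤z z≤h → <-≮-trans h+1<m (LminAt-below M lo≤z (≤-pred z≤h))
            ; start = λ z h+1<z z≤h+1 → contradiction z≤h+1 (<⇒≱ h+1<z) }
  ...     | no h+1≮m = m , record
            { lo≤m = LminAt.lo≤m M ; m≤hi = m≤n⇒m≤1+n (LminAt.m≤hi M)
            ; end = LminAt.end M
            ; start = start }
    where
      start : LminAtStart f m (suc h)
      start z m<z z≤h+1 with m≤n⇒m<n∨m≡n z≤h+1
      ... | inj₁ z≤h = LminAt.start M z m<z (≤-pred z≤h)
      ... | inj₂ refl = h+1≮m

  LminAtStart⇔≡lmin : ∀ {f lo hi m a b} → LminAt f lo hi m → lo ≤ a → a ≤ m → m ≤ b → b ≤ hi →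
                      LminAtStart f a b ⇔ a ≡ m
  LminAtStart⇔≡lmin {f} {m = m} {a} {b} M lo≤a a≤m m≤b b≤hi =
    mk⇔ a≡m (λ { refl → LminAtStart-shrink b≤hi (LminAt.start M) })
    where
      a≡m : LminAtStart f a b → a ≡ m
      a≡m L with m≤n⇒m<n∨m≡n a≤m
      ... | inj₁ a<m = contradiction (LminAt.end M a lo≤a a<m) (L m a<m m≤b)
      ... | inj₂ a≡m = a≡m

  LminAtEnd⇔≡lmin : ∀ {f lo hi m a b} → LminAt f lo hi m → lo ≤ a → a ≤ m → m ≤ b → b ≤ hi →
                    LminAtEnd f a b ⇔ b ≡ m
  LminAtEnd⇔≡lmin {f} {m = m} {a} {b} M lo≤a a≤m m≤b b≤hi =
    mk⇔ b≡m (λ { refl → LminAtEnd-shrink lo≤a (LminAt.end M) })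
    where
      b≡m : LminAtEnd f a b → b ≡ m
      b≡m R with m≤n⇒m<n∨m≡n m≤b
      ... | inj₁ m<b = contradiction (R m a≤m m<b) (LminAt.start M b m<b b≤hi)
      ... | inj₂ m≡b = sym m≡b

  CTEquivOn-split : ∀ {f h lo hi t} → LminAt f lo hi (suc t) → LminAt h lo hi (suc t) →
                    CTEquivOn f h lo t → CTEquivOn f h (2 + t) hi → CTEquivOn f h lo hi
  CTEquivOn-split {t = t} Mf Mh El Er a b lo≤a a≤b b≤hi with b ≤? t | suc t <? a
  ... | yes b≤t | _ = El a b lo≤a a≤b b≤t
  ... | no _ | yes t+1<a = Er a b t+1<a a≤b b≤hi
  ... | no b≰t | no t+1≮a =
    ⇔-trans (LminAtStart⇔≡lmin Mf lo≤a a≤m m≤b b≤hi) (⇔-sym (LminAtStart⇔≡lmin Mh lo≤a a≤m m≤b b≤hi)) ,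
    ⇔-trans (LminAtEnd⇔≡lmin Mf lo≤a a≤m m≤b b≤hi) (⇔-sym (LminAtEnd⇔≡lmin Mh lo≤a a≤m m≤b b≤hi))
    where
      a≤m = ≮⇒≥ t+1≮a
      m≤b = ≰⇒> b≰t

  LminAt-unique : ∀ {f lo hi m m′} → LminAt f lo hi m → LminAt f lo hi m′ → m ≡ m′
  LminAt-unique {m = m} {m′} M M′ with ≤-total m m′
  ... | inj₁ m≤m′ = to (LminAtStart⇔≡lmin M′ (LminAt.lo≤m M) m≤m′ (LminAt.m≤hi M′) ≤-refl) (LminAt.start M)
  ... | inj₂ m′≤m = sym (to (LminAtStart⇔≡lmin M (LminAt.lo≤m M′) m′≤m (LminAt.m≤hi M) ≤-refl) (LminAt.start M′))

  CTEquivOn-LminAt : ∀ {f h lo hi m} → CTEquivOn f h lo hi → LminAt f lo hi m → LminAt h lo hi m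
  CTEquivOn-LminAt {lo = lo} {hi} E M = record
    { lo≤m = lo≤m ; m≤hi = m≤hi
    ; end = to (proj₂ (E lo _ ≤-refl lo≤m (m≤hi))) end
    ; start = to (proj₁ (E _ hi lo≤m m≤hi ≤-refl)) start }
    where open LminAt M

  module _ {D : ℕ → Set} (D? : Decidable D) {f h : Seq} {w : ℕ}
           (f≗h : ∀ z → ¬ D z → f z ≡ h z) (w∉D : ¬ D w) (w-dominates : ∀ z → D z → h w ⊏ h z) {a b : ℕ} where

    LminAtEnd-dominated : a ≤ w → w < b → ¬ D b → LminAtEnd f a b → LminAtEnd h a b
    LminAtEnd-dominated a≤w w<b b∉D R z a≤z z<b with D? z
    ... | yes z∈D = ⊏-trans (subst₂ _⊏_ (f≗h b b∉D) (f≗h w w∉D) (R w a≤w w<b))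
                            (w-dominates z z∈D)
    ... | no z∉D = subst₂ _⊏_ (f≗h b b∉D) (f≗h z z∉D) (R z a≤z z<b)

    LminAtStart-dominated : a < w → w ≤ b → ¬ D a → LminAtStart f a b → LminAtStart h a b
    LminAtStart-dominated a<w w≤b a∉D L z a<z z≤b hz<ha with D? z
    ... | yes z∈D = L w a<w w≤b (subst₂ _⊏_ (sym (f≗h w w∉D)) (sym (f≗h a a∉D))
                                   (⊏-trans (w-dominates z z∈D) hz<ha))
    ... | no z∉D = L z a<z z≤b (subst₂ _⊏_ (sym (f≗h z z∉D)) (sym (f≗h a a∉D)) hz<ha)

  -- Splicing a block

  opaque
    splice : ℕ → ℕ → Seq → Seq → Seq
    splice ci cj x x′ z with inBlock? ci cj z
    ... | yes _ = x z
    ... | no _ = x′ z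

    splice-in : ∀ {ci cj x x′ z} → InBlock ci cj z → splice ci cj x x′ z ≡ x z
    splice-in {ci} {cj} {z = z} z∈ with inBlock? ci cj z
    ... | yes _ = refl
    ... | no z∉ = contradiction z∈ z∉

    splice-out : ∀ {ci cj x x′ z} → ¬ InBlock ci cj z → splice ci cj x x′ z ≡ x′ z
    splice-out {ci} {cj} {z = z} z∉ with inBlock? ci cj z
    ... | yes z∈ = contradiction z∈ z∉
    ... | no _ = refl

  module Splice (x x′ y : Seq) {n A ci cj : ℕ}
    (A<ci : A < ci) (ci<cj : ci < cj) (cj≤n : cj ≤ n)
    (x′≈y : CTEquivOn x′ y 1 n) (x≈y : CTEquivOn x y (suc A) cj)
    (x-end-cj : LminAtEnd x (suc A) cj) (y-end-ci : LminAtEnd y (suc A) ci) (y-end-cj : LminAtEnd y (suc A) cj)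
    (y-extend : ∀ m → 1 ≤ m → m ≤ A → LminAtStart y m ci → LminAtStart y m cj)
    (x′ci≡xci : x′ ci ≡ x ci) (x′cj≡xcj : x′ cj ≡ x cj) where

    x″ : Seq
    x″ = splice ci cj x x′

    Shadowed : ℕ → Set
    Shadowed z = ci < z × z < cj

    shadowed? : Decidable Shadowed
    shadowed? z = (ci <? z) ×-dec (z <? cj)

    ci≤n : ci ≤ n
    ci≤n = ≤-trans (<⇒≤ ci<cj) cj≤n

    x″≡x : ∀ {z} → ci ≤ z → z ≤ cj → x″ z ≡ x z
    x″≡x {z} ci≤z z≤cj with m≤n⇒m<n∨m≡n ci≤z
    ... | inj₁ ci<z = splice-in {ci} {cj} {x} {x′} (ci<z , z≤cj)
    ... | inj₂ refl = trans (splice-out {ci} {cj} {x} {x′} (λ (ci<ci , _) → <-irrefl refl ci<ci)) x′ci≡xci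

    x″≡x′ : ∀ z → ¬ Shadowed z → x″ z ≡ x′ z
    x″≡x′ z z∉ with z ≟ cj
    ... | yes refl = trans (x″≡x (<⇒≤ ci<cj) ≤-refl) (sym x′cj≡xcj)
    ... | no z≢cj = splice-out {ci} {cj} {x} {x′} (λ (ci<z , z≤cj) → z∉ (ci<z , ≤∧≢⇒< z≤cj z≢cj))

    x′-end-ci : LminAtEnd x′ (suc A) ci
    x′-end-ci = from (proj₂ (x′≈y (suc A) ci (s≤s z≤n) A<ci ci≤n)) y-end-ci

    x′-end-cj : LminAtEnd x′ (suc A) cj
    x′-end-cj = from (proj₂ (x′≈y (suc A) cj (s≤s z≤n) (<-trans A<ci ci<cj) cj≤n)) y-end-cj

    x′-extend : ∀ m → 1 ≤ m → m ≤ A → LminAtStart x′ m ci → LminAtStart x′ m cj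
    x′-extend m 1≤m m≤A L =
      from (proj₁ (x′≈y m cj 1≤m m≤cj cj≤n)) (y-extend m 1≤m m≤A (to (proj₁ (x′≈y m ci 1≤m m≤ci ci≤n)) L))
      where
        m≤ci = ≤-trans m≤A (<⇒≤ A<ci)
        m≤cj = ≤-trans m≤ci (<⇒≤ ci<cj)

    cj-unshadowed : ¬ Shadowed cj
    cj-unshadowed (_ , cj<cj) = <-irrefl refl cj<cj

    x′-cj-dominates : ∀ z → Shadowed z → x′ cj ⊏ x′ z
    x′-cj-dominates z (ci<z , z<cj) = x′-end-cj z (<-trans A<ci ci<z) z<cj

    x″-cj-dominates : ∀ z → Shadowed z → x″ cj ⊏ x″ z
    x″-cj-dominates z (ci<z , z<cj) =
      subst₂ _⊏_ (sym (x″≡x (<⇒≤ ci<cj) ≤-refl)) (sym (x″≡x (<⇒≤ ci<z) (<⇒≤ z<cj)))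
                 (x-end-cj z (<-trans A<ci ci<z) z<cj)

    x-cj-below : ∀ {z} → ci < z → z ≤ cj → ¬ (x z ⊏ x cj)
    x-cj-below ci<z z≤cj = LminAtEnd-below x-end-cj (<-trans A<ci ci<z) z≤cj

    across-start : ∀ {a b} → 1 ≤ a → a < cj → cj < b → b ≤ n → LminAtStart x″ a b ⇔ LminAtStart y a b
    across-start {a} {b} 1≤a a<cj cj<b b≤n with ci <? a
    ... | yes ci<a = ¬×¬⇒⇔ (λ L → L cj a<cj (<⇒≤ cj<b) (x″-cj-dominates a (ci<a , a<cj)))
                           (λ L → L cj a<cj (<⇒≤ cj<b) (y-end-cj a (<-trans A<ci ci<a) a<cj))
    ... | no ci≮a = ⇔-trans
      (mk⇔ (LminAtStart-dominated shadowed? x″≡x′ cj-unshadowed x′-cj-dominates a<cj (<⇒≤ cj<b) a-unshadowed)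
           (LminAtStart-dominated shadowed? (λ z z∉ → sym (x″≡x′ z z∉)) cj-unshadowed x″-cj-dominates
                                  a<cj (<⇒≤ cj<b) a-unshadowed))
      (proj₁ (x′≈y a b 1≤a (<⇒≤ (<-trans a<cj cj<b)) b≤n))
      where
        a-unshadowed : ¬ Shadowed a
        a-unshadowed (ci<a , _) = ci≮a ci<a

    across-end : ∀ {a b} → 1 ≤ a → a < cj → cj < b → b ≤ n → LminAtEnd x″ a b ⇔ LminAtEnd y a b
    across-end {a} {b} 1≤a a<cj cj<b b≤n = ⇔-trans
      (mk⇔ (LminAtEnd-dominated shadowed? x″≡x′ cj-unshadowed x′-cj-dominates (<⇒≤ a<cj) cj<b b-unshadowed)
           (LminAtEnd-dominated shadowed? (λ z z∉ → sym (x″≡x′ z z∉)) cj-unshadowed x″-cj-dominates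
                                (<⇒≤ a<cj) cj<b b-unshadowed))
      (proj₂ (x′≈y a b 1≤a (<⇒≤ (<-trans a<cj cj<b)) b≤n))
      where
        b-unshadowed : ¬ Shadowed b
        b-unshadowed (_ , b<cj) = <-asym b<cj cj<b

    x″≗x′-upto-ci : ∀ {a} → AgreeOn x″ x′ a ci
    x″≗x′-upto-ci z _ z≤ci = x″≡x′ z (λ (ci<z , _) → <⇒≱ ci<z z≤ci)

    x″≗x-from-ci : ∀ {b} → b ≤ cj → AgreeOn x″ x ci b
    x″≗x-from-ci b≤cj z ci≤z z≤b = x″≡x ci≤z (≤-trans z≤b b≤cj)

    entering-start : ∀ {a b} → 1 ≤ a → a < ci → ci < b → b ≤ cj → LminAtStart x″ a b ⇔ LminAtStart y a b
    entering-start {a} {b} 1≤a a<ci ci<b b≤cj with a ≤? A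
    ... | no a≰A = ¬×¬⇒⇔ (λ L → L ci a<ci (<⇒≤ ci<b) x″ci<x″a) (λ L → L ci a<ci (<⇒≤ ci<b) (y-end-ci a A<a a<ci))
      where
        A<a = ≰⇒> a≰A
        x″ci<x″a : x″ ci ⊏ x″ a
        x″ci<x″a = subst₂ _⊏_ (sym (x″≗x′-upto-ci ci (<⇒≤ a<ci) ≤-refl))
                              (sym (x″≗x′-upto-ci a ≤-refl (<⇒≤ a<ci)))
                              (x′-end-ci a A<a a<ci)
    ... | yes a≤A = mk⇔ forth back
      where
        a≤ci = <⇒≤ a<ci
        a≤cj = ≤-trans a≤ci (<⇒≤ ci<cj)
        forth : LminAtStart x″ a b → LminAtStart y a b
        forth L = LminAtStart-shrink b≤cj (y-extend a 1≤a a≤A (to (proj₁ (x′≈y a ci 1≤a a≤ci ci≤n))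
                    (LminAtStart-cong a≤ci x″≗x′-upto-ci (LminAtStart-shrink (<⇒≤ ci<b) L))))
        x′-extended : LminAtStart y a b → LminAtStart x′ a cj
        x′-extended L = from (proj₁ (x′≈y a cj 1≤a a≤cj cj≤n)) (y-extend a 1≤a a≤A (LminAtStart-shrink (<⇒≤ ci<b) L))
        back : LminAtStart y a b → LminAtStart x″ a b
        back L z a<z z≤b with z ≤? ci
        ... | yes z≤ci =
          LminAtStart-cong a≤ci (AgreeOn-sym x″≗x′-upto-ci) (LminAtStart-shrink (<⇒≤ ci<cj) (x′-extended L)) z a<z z≤ci
        ... | no z≰ci =
          subst₂ (λ u v → ¬ (u ⊏ v)) (sym (x″≡x (<⇒≤ ci<z) z≤cj)) (sym (x″≗x′-upto-ci a ≤-refl a≤ci))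
            (≮-trans (x-cj-below ci<z z≤cj) (subst (λ u → ¬ (u ⊏ x′ a)) x′cj≡xcj (x′-extended L cj a<cj ≤-refl)))
          where
            ci<z = ≰⇒> z≰ci
            z≤cj = ≤-trans z≤b b≤cj
            a<cj = <-trans a<ci ci<cj

    -- Otherwise the leftmost minimum of h[a..ci] sits at some m ≤ A (h[ci] is below h(A..ci)), and extending
    -- it to cj gives h[m] ≤ h[cj] ≤ S[b] < S[m] = h[m].
    LminAtEnd-ci : ∀ (h S : Seq) {a b} → 1 ≤ a → a < ci → ci < b →
                   LminAtEnd h (suc A) ci → (∀ m → 1 ≤ m → m ≤ A → LminAtStart h m ci → LminAtStart h m cj) →
                   AgreeOn S h a ci → ¬ (S b ⊏ h cj) → LminAtEnd S a b → LminAtEnd h a ci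
    LminAtEnd-ci h S {a} {b} 1≤a a<ci ci<b h-ci h-extend S≗h Sb≮hcj R with lmin-exists h ci (<⇒≤ a<ci)
    ... | m , M with m ≟ ci
    ...   | yes refl = LminAt.end M
    ...   | no m≢ci with m ≤? A
    ...     | no m≰A = contradiction (h-ci m (≰⇒> m≰A) m<ci) (LminAt.start M ci m<ci ≤-refl)
      where m<ci = ≤∧≢⇒< (LminAt.m≤hi M) m≢ci
    ...     | yes m≤A = contradiction
                (≮-<-trans Sb≮hcj (subst (S b ⊏_) (S≗h m a≤m m≤ci) (R m a≤m (<-trans m<ci ci<b))))
                (h-extend m (≤-trans 1≤a a≤m) m≤A (LminAt.start M) cj (<-trans m<ci ci<cj) ≤-refl)
      where
        a≤m = LminAt.lo≤m M
        m≤ci = LminAt.m≤hi M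
        m<ci = ≤∧≢⇒< m≤ci m≢ci

    entering-end : ∀ {a b} → 1 ≤ a → a < ci → ci < b → b ≤ cj → LminAtEnd x″ a b ⇔ LminAtEnd y a b
    entering-end {a} {b} 1≤a a<ci ci<b b≤cj = mk⇔ forth back
      where
        a≤ci = <⇒≤ a<ci
        ci≤b = <⇒≤ ci<b
        x″≈y-from-ci : SameEndMinima x″ y ci b
        x″≈y-from-ci = SameEndMinima-trans (AgreeOn⇒SameEndMinima ci≤b (x″≗x-from-ci b≤cj)) (x≈y ci b A<ci ci≤b b≤cj)
        x″≈y-upto-ci : SameEndMinima x″ y a ci
        x″≈y-upto-ci = SameEndMinima-trans (AgreeOn⇒SameEndMinima a≤ci x″≗x′-upto-ci) (x′≈y a ci 1≤a a≤ci ci≤n)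
        x″b≮x′cj : ¬ (x″ b ⊏ x′ cj)
        x″b≮x′cj = subst₂ (λ u v → ¬ (u ⊏ v)) (sym (x″≡x ci≤b b≤cj)) (sym x′cj≡xcj) (x-cj-below ci<b b≤cj)
        forth : LminAtEnd x″ a b → LminAtEnd y a b
        forth R = LminAtEnd-join a≤ci ci<b
          (to (proj₂ (x′≈y a ci 1≤a a≤ci ci≤n))
              (LminAtEnd-ci x′ x″ 1≤a a<ci ci<b x′-end-ci x′-extend x″≗x′-upto-ci x″b≮x′cj R))
          (to (proj₂ x″≈y-from-ci) (LminAtEnd-shrink a≤ci R))
        back : LminAtEnd y a b → LminAtEnd x″ a b
        back R = LminAtEnd-join a≤ci ci<b
          (from (proj₂ x″≈y-upto-ci)
                (LminAtEnd-ci y y 1≤a a<ci ci<b y-end-ci y-extend (λ _ _ _ → refl)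
                              (LminAtEnd-below y-end-cj (<-trans A<ci ci<b) b≤cj) R))
          (from (proj₂ x″≈y-from-ci) (LminAtEnd-shrink a≤ci R))

    splice-CTEquivOn : CTEquivOn x″ y 1 n
    splice-CTEquivOn a b 1≤a a≤b b≤n with cj <? b
    ... | yes cj<b with cj ≤? a
    ...   | yes cj≤a = SameEndMinima-trans
                         (AgreeOn⇒SameEndMinima a≤b (λ z a≤z _ → x″≡x′ z (λ (_ , z<cj) → <⇒≱ z<cj (≤-trans cj≤a a≤z))))
                         (x′≈y a b 1≤a a≤b b≤n)
    ...   | no cj≰a = across-start 1≤a (≰⇒> cj≰a) cj<b b≤n , across-end 1≤a (≰⇒> cj≰a) cj<b b≤n
    splice-CTEquivOn a b 1≤a a≤b b≤n | no cj≮b with b ≤? ci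
    ... | yes b≤ci = SameEndMinima-trans
                       (AgreeOn⇒SameEndMinima a≤b (λ z a≤z z≤b → x″≗x′-upto-ci z a≤z (≤-trans z≤b b≤ci)))
                       (x′≈y a b 1≤a a≤b b≤n)
    ... | no b≰ci with ci ≤? a
    ...   | yes ci≤a = SameEndMinima-trans
                         (AgreeOn⇒SameEndMinima a≤b (λ z a≤z z≤b → x″≡x (≤-trans ci≤a a≤z) (≤-trans z≤b b≤cj)))
                         (x≈y a b (<-≤-trans A<ci ci≤a) a≤b b≤cj)
      where b≤cj = ≮⇒≥ cj≮b
    ...   | no ci≰a = entering-start 1≤a (≰⇒> ci≰a) (≰⇒> b≰ci) (≮⇒≥ cj≮b) ,
                      entering-end 1≤a (≰⇒> ci≰a) (≰⇒> b≰ci) (≮⇒≥ cj≮b)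

  module Indexing (d : Carrier) where
    open Strings O

    infixl 9 _!_

    -- 1-based; positions outside [1, length S] read the filler d.
    _!_ : Str → ℕ → Carrier
    [] ! _ = d
    (x ∷ xs) ! zero = d
    (x ∷ xs) ! suc zero = x
    (x ∷ xs) ! suc (suc i) = xs ! suc i

    !-zero : ∀ S → S ! 0 ≡ d
    !-zero [] = refl
    !-zero (x ∷ S) = refl

    !-∷ : ∀ x xs {i} → 1 ≤ i → (x ∷ xs) ! suc i ≡ xs ! i
    !-∷ x xs {suc i} _ = refl

    !-++ˡ : ∀ xs ys {i} → i ≤ length xs → (xs ++ ys) ! i ≡ xs ! i
    !-++ˡ [] ys {zero} _ = !-zero ys
    !-++ˡ (x ∷ xs) ys {zero} _ = refl
    !-++ˡ (x ∷ xs) ys {suc zero} _ = refl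
    !-++ˡ (x ∷ xs) ys {suc (suc i)} (s≤s i<) = !-++ˡ xs ys i<

    !-++ʳ : ∀ xs ys {i} → 1 ≤ i → (xs ++ ys) ! (length xs + i) ≡ ys ! i
    !-++ʳ [] ys _ = refl
    !-++ʳ (x ∷ xs) ys {i} 1≤i = trans (!-∷ x (xs ++ ys) (≤-trans 1≤i (m≤n+m i (length xs)))) (!-++ʳ xs ys 1≤i)

    !-take : ∀ t S {i} → i ≤ t → take t S ! i ≡ S ! i
    !-take zero S {zero} _ = sym (!-zero S)
    !-take (suc t) [] _ = refl
    !-take (suc t) (x ∷ xs) {zero} _ = refl
    !-take (suc t) (x ∷ xs) {suc zero} _ = refl
    !-take (suc t) (x ∷ xs) {suc (suc i)} (s≤s i≤t) = !-take t xs i≤t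

    !-drop : ∀ k S {i} → 1 ≤ i → drop k S ! i ≡ S ! (k + i)
    !-drop zero S _ = refl
    !-drop (suc k) [] _ = refl
    !-drop (suc k) (x ∷ xs) {i} 1≤i = trans (!-drop k xs 1≤i) (sym (!-∷ x xs (≤-trans 1≤i (m≤n+m i k))))

    lmin-spec : ∀ x xs → proj₂ (lmin x xs) ≡ (x ∷ xs) ! suc (proj₁ (lmin x xs)) ×
                         LminAt ((x ∷ xs) !_) 1 (suc (length xs)) (suc (proj₁ (lmin x xs)))
    lmin-spec x [] = refl , LminAt-refl
    lmin-spec x (y ∷ ys) with lmin y ys | lmin-spec y ys
    ... | j , m | m≡ , M with m ⊏? x
    ...   | yes m<x = m≡ , record { lo≤m = s≤s z≤n ; m≤hi = s≤s (LminAt.m≤hi M) ; end = end ; start = start }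
      where
        end : LminAtEnd ((x ∷ y ∷ ys) !_) 1 (suc (suc j))
        end (suc zero) _ _ = subst (_⊏ x) m≡ m<x
        end (suc (suc z)) _ (s≤s z<) = LminAt.end M (suc z) (s≤s z≤n) z<
        start : LminAtStart ((x ∷ y ∷ ys) !_) (suc (suc j)) (suc (suc (length ys)))
        start (suc (suc z)) (s≤s j<z) (s≤s z≤) = LminAt.start M (suc z) j<z z≤
    ...   | no m≮x = refl , record
              { lo≤m = s≤s z≤n ; m≤hi = s≤s z≤n ; end = λ z 1≤z z<1 → contradiction z<1 (≤⇒≯ 1≤z) ; start = start }
      where
        start : LminAtStart ((x ∷ y ∷ ys) !_) 1 (suc (suc (length ys)))
        start (suc zero) (s≤s ()) _
        start (suc (suc z)) _ (s≤s z≤) = ≮-trans (LminAt-below M (s≤s z≤n) z≤) (subst (λ u → ¬ (u ⊏ x)) m≡ m≮x)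

    -- Cartesian trees

    size-CT′ : ∀ f S → length S ≤ f → size (CT′ f S) ≡ length S
    size-CT′ zero [] _ = refl
    size-CT′ (suc f) [] _ = refl
    size-CT′ (suc f) (x ∷ xs) (s≤s |xs|≤f) with lmin x xs | lmin-spec x xs
    ... | t , _ | _ , M = cong suc (begin
        size (CT′ f (take t (x ∷ xs))) + size (CT′ f (drop t xs))
          ≡⟨ cong₂ _+_ (size-CT′ f (take t (x ∷ xs)) (subst (_≤ f) (sym |left|≡t) (≤-trans t≤ |xs|≤f)))
                       (size-CT′ f (drop t xs) (subst (_≤ f) (sym (length-drop t xs)) (≤-trans (m∸n≤m _ t) |xs|≤f))) ⟩
        length (take t (x ∷ xs)) + length (drop t xs)
          ≡⟨ cong₂ _+_ |left|≡t (length-drop t xs) ⟩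
        t + (length xs ∸ t)
          ≡⟨ m+[n∸m]≡n t≤ ⟩
        length xs ∎)
      where
        open ≡-Reasoning
        t≤ = ≤-pred (LminAt.m≤hi M)
        |left|≡t = length-take-≤ t (x ∷ xs) (m≤n⇒m≤1+n t≤)

    CT′-length : ∀ {f S T} → length S ≤ f → length T ≤ f → CT′ f S ≡ CT′ f T → length S ≡ length T
    CT′-length {f} {S} {T} S≤f T≤f eq = trans (sym (size-CT′ f S S≤f)) (trans (cong size eq) (size-CT′ f T T≤f))

    CTEquivOn-empty : ∀ {f h} → CTEquivOn f h 1 0
    CTEquivOn-empty a b 1≤a a≤b b≤0 = contradiction (≤-trans 1≤a (≤-trans a≤b b≤0)) λ ()

    CTEquivOn-take : ∀ S T t → CTEquivOn (take t S !_) (take t T !_) 1 t → CTEquivOn (S !_) (T !_) 1 t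
    CTEquivOn-take S T t = CTEquivOn-cong (λ z _ z≤t → !-take t S z≤t) (λ z _ z≤t → !-take t T z≤t)

    CTEquivOn-drop : ∀ S T k {hi} → CTEquivOn (drop k S !_) (drop k T !_) 1 hi → CTEquivOn (S !_) (T !_) (k + 1) (k + hi)
    CTEquivOn-drop S T k E = CTEquivOn-shift (S !_) (T !_) k
      (CTEquivOn-cong (λ z 1≤z _ → !-drop k S 1≤z) (λ z 1≤z _ → !-drop k T 1≤z) E)

    CTEquivOn-node : ∀ {S T n t} → LminAt (S !_) 1 n (suc t) → LminAt (T !_) 1 n (suc t) →
                     CTEquivOn (take t S !_) (take t T !_) 1 t →
                     CTEquivOn (drop (suc t) S !_) (drop (suc t) T !_) 1 (n ∸ suc t) →
                     CTEquivOn (S !_) (T !_) 1 n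
    CTEquivOn-node {S} {T} {t = t} MS MT Eˡ Eʳ = CTEquivOn-split MS MT (CTEquivOn-take S T t Eˡ)
      (subst₂ (CTEquivOn _ _) (+-comm (suc t) 1) (m+[n∸m]≡n (LminAt.m≤hi MS)) (CTEquivOn-drop S T (suc t) Eʳ))

    CTEquivOn-subtrees : ∀ S T {n} t → t < n → CTEquivOn (S !_) (T !_) 1 n →
                         CTEquivOn (take t S !_) (take t T !_) 1 t ×
                         CTEquivOn (drop (suc t) S !_) (drop (suc t) T !_) 1 (n ∸ suc t)
    CTEquivOn-subtrees S T t t<n E =
      CTEquivOn-cong (λ z _ z≤t → sym (!-take t S z≤t)) (λ z _ z≤t → sym (!-take t T z≤t))
        (CTEquivOn-shrink ≤-refl (<⇒≤ t<n) E) ,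
      CTEquivOn-cong (λ z 1≤z _ → sym (!-drop (suc t) S 1≤z)) (λ z 1≤z _ → sym (!-drop (suc t) T 1≤z))
        (CTEquivOn-unshift (S !_) (T !_) (suc t) (CTEquivOn-shrink (s≤s z≤n) (≤-reflexive (m+[n∸m]≡n t<n)) E))

    CT′≡⇒CTEquivOn : ∀ f S T → length S ≤ f → length T ≤ f → CT′ f S ≡ CT′ f T → CTEquivOn (S !_) (T !_) 1 (length S)
    CT′≡⇒CTEquivOn zero [] _ _ _ _ = CTEquivOn-empty
    CT′≡⇒CTEquivOn (suc f) [] [] _ _ _ = CTEquivOn-empty
    CT′≡⇒CTEquivOn (suc f) S@(x ∷ xs) T@(y ∷ ys) S≤f@(s≤s xs≤f) T≤f@(s≤s ys≤f) eq =
      node-case (proj₂ (lmin-spec x xs)) (proj₂ (lmin-spec y ys)) (cong left eq) (cong right eq)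
      where
        |S|≡|T| : length S ≡ length T
        |S|≡|T| = CT′-length S≤f T≤f eq

        t≤ : ∀ U {t} → LminAt (U !_) 1 (length U) (suc t) → t ≤ length U
        t≤ U M = ≤-trans (n≤1+n _) (LminAt.m≤hi M)

        fuelˡ : ∀ U {t} → LminAt (U !_) 1 (length U) (suc t) → length U ≤ suc f → length (take t U) ≤ f
        fuelˡ U {t} M U≤ = subst (_≤ f) (sym (length-take-≤ t U (t≤ U M))) (≤-pred (≤-trans (LminAt.m≤hi M) U≤))

        fuelʳ : ∀ us t → length us ≤ f → length (drop t us) ≤ f
        fuelʳ us t us≤f = subst (_≤ f) (sym (length-drop t us)) (≤-trans (m∸n≤m _ t) us≤f)

        t≡t′ : ∀ {t t′} → LminAt (S !_) 1 (length S) (suc t) → LminAt (T !_) 1 (length T) (suc t′) →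
               CT′ f (take t S) ≡ CT′ f (take t′ T) → t ≡ t′
        t≡t′ {t} {t′} MS MT eqˡ =
          trans (sym (length-take-≤ t S (t≤ S MS)))
                (trans (CT′-length (fuelˡ S MS S≤f) (fuelˡ T MT T≤f) eqˡ) (length-take-≤ t′ T (t≤ T MT)))

        node-case : ∀ {t t′} → LminAt (S !_) 1 (length S) (suc t) → LminAt (T !_) 1 (length T) (suc t′) →
                    CT′ f (take t S) ≡ CT′ f (take t′ T) → CT′ f (drop t xs) ≡ CT′ f (drop t′ ys) →
                    CTEquivOn (S !_) (T !_) 1 (length S)
        node-case {t} {t′} MS MT eqˡ eqʳ with t≡t′ MS MT eqˡ
        ... | refl = CTEquivOn-node MS (subst (λ n → LminAt (T !_) 1 n (suc t)) (sym |S|≡|T|) MT)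
          (subst (CTEquivOn _ _ 1) (length-take-≤ t S (t≤ S MS))
                 (CT′≡⇒CTEquivOn f (take t S) (take t T) (fuelˡ S MS S≤f) (fuelˡ T MT T≤f) eqˡ))
          (subst (CTEquivOn _ _ 1) (length-drop t xs)
                 (CT′≡⇒CTEquivOn f (drop t xs) (drop t ys) (fuelʳ xs t xs≤f) (fuelʳ ys t ys≤f) eqʳ))

    CTEquivOn⇒CT′≡ : ∀ f S T → length S ≡ length T → CTEquivOn (S !_) (T !_) 1 (length S) → CT′ f S ≡ CT′ f T
    CTEquivOn⇒CT′≡ zero [] [] _ _ = refl
    CTEquivOn⇒CT′≡ zero (_ ∷ _) (_ ∷ _) _ _ = refl
    CTEquivOn⇒CT′≡ (suc f) [] [] _ _ = refl
    CTEquivOn⇒CT′≡ (suc f) S@(x ∷ xs) T@(y ∷ ys) |S|≡|T| E = node-case (proj₂ (lmin-spec x xs)) (proj₂ (lmin-spec y ys))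
      where
        node-case : ∀ {t t′} → LminAt (S !_) 1 (length S) (suc t) → LminAt (T !_) 1 (length T) (suc t′) →
                    node (CT′ f (take t S)) (CT′ f (drop t xs)) ≡ node (CT′ f (take t′ T)) (CT′ f (drop t′ ys))
        node-case {t} {t′} MS MT
          with LminAt-unique (CTEquivOn-LminAt E MS) (subst (λ n → LminAt (T !_) 1 n (suc t′)) (sym |S|≡|T|) MT)
        ... | refl = cong₂ node
          (CTEquivOn⇒CT′≡ f (take t S) (take t T) |Sˡ|≡|Tˡ| (subst (CTEquivOn _ _ 1) (sym |Sˡ|≡t) Eˡ))
          (CTEquivOn⇒CT′≡ f (drop t xs) (drop t ys) |Sʳ|≡|Tʳ| (subst (CTEquivOn _ _ 1) (sym (length-drop t xs)) Eʳ))
          where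
            t<|S| = LminAt.m≤hi MS
            Eˡ : CTEquivOn (take t S !_) (take t T !_) 1 t
            Eˡ = proj₁ (CTEquivOn-subtrees S T t t<|S| E)
            Eʳ : CTEquivOn (drop t xs !_) (drop t ys !_) 1 (length xs ∸ t)
            Eʳ = proj₂ (CTEquivOn-subtrees S T t t<|S| E)
            |Sˡ|≡t = length-take-≤ t S (<⇒≤ t<|S|)
            |Sˡ|≡|Tˡ| = trans |Sˡ|≡t (sym (length-take-≤ t T (<⇒≤ (subst (t <_) |S|≡|T| t<|S|))))
            |Sʳ|≡|Tʳ| = trans (length-drop t xs) (trans (cong (_∸ t) (suc-injective |S|≡|T|)) (sym (length-drop t ys)))

    ≈CT⇒CTEquivOn : ∀ {S T} → S ≈CT T → length S ≡ length T × CTEquivOn (S !_) (T !_) 1 (length S)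
    ≈CT⇒CTEquivOn {S} {T} S≈T = |S|≡|T| , CT′≡⇒CTEquivOn (length S) S T ≤-refl (≤-reflexive (sym |S|≡|T|))
      (subst (λ n → CT′ (length S) S ≡ CT′ n T) (sym |S|≡|T|) S≈T)
      where
        |S|≡|T| : length S ≡ length T
        |S|≡|T| = trans (sym (size-CT′ _ S ≤-refl)) (trans (cong size S≈T) (size-CT′ _ T ≤-refl))

    CTEquivOn⇒≈CT : ∀ {S T} → length S ≡ length T → CTEquivOn (S !_) (T !_) 1 (length S) → S ≈CT T
    CTEquivOn⇒≈CT {S} {T} |S|≡|T| E =
      subst (λ n → CT′ (length S) S ≡ CT′ n T) |S|≡|T| (CTEquivOn⇒CT′≡ (length S) S T |S|≡|T| E)

    -- Next smaller values

    record IsFirstLess (v : Carrier) (zs : Str) (k : ℕ) : Set ℓ₂ where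
      field
        1≤k : 1 ≤ k
        before : ∀ j → 1 ≤ j → j < k → ¬ (zs ! j ⊏ v)
        found : k ≤ length zs → zs ! k ⊏ v

    firstLess-spec : ∀ v zs → IsFirstLess v zs (firstLess v zs)
    firstLess-spec v [] = record { 1≤k = s≤s z≤n ; before = λ j 1≤j j<1 → contradiction j<1 (≤⇒≯ 1≤j) ; found = λ () }
    firstLess-spec v (z ∷ zs) with z ⊏? v
    ... | yes z<v = record { 1≤k = s≤s z≤n ; before = λ j 1≤j j<1 → contradiction j<1 (≤⇒≯ 1≤j) ; found = λ _ → z<v }
    ... | no z≮v = record { 1≤k = s≤s z≤n ; before = before ; found = found }
      where
        open IsFirstLess (firstLess-spec v zs) using () renaming (1≤k to 1≤k′; before to before′; found to found′)
        before : ∀ j → 1 ≤ j → j < suc (firstLess v zs) → ¬ ((z ∷ zs) ! j ⊏ v)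
        before (suc zero) _ _ = z≮v
        before (suc (suc j)) _ (s≤s j<) = before′ (suc j) (s≤s z≤n) j<
        found : suc (firstLess v zs) ≤ suc (length zs) → (z ∷ zs) ! suc (firstLess v zs) ⊏ v
        found (s≤s fl≤) = subst (_⊏ v) (sym (!-∷ z zs 1≤k′)) (found′ fl≤)

    drop-! : ∀ Y a → a < length Y → drop a Y ≡ Y ! suc a ∷ drop (suc a) Y
    drop-! (y ∷ ys) zero _ = refl
    drop-! (y ∷ ys) (suc a) (s≤s a<) = drop-! ys a a<

    nsv-firstLess : ∀ Y a → a < length Y → nsv Y (suc a) ≡ suc a + firstLess (Y ! suc a) (drop (suc a) Y)
    nsv-firstLess Y a a< with drop a Y | drop-! Y a a<
    ... | _ | refl = refl

    LminAtStart⇔<nsv : ∀ Y {i b} → 1 ≤ i → i ≤ length Y → b ≤ length Y → LminAtStart (Y !_) i b ⇔ b < nsv Y i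
    LminAtStart⇔<nsv Y {suc a} {b} _ i≤|Y| b≤|Y| = mk⇔ forth back
      where
        v = Y ! suc a
        k = firstLess v (drop (suc a) Y)
        open IsFirstLess (firstLess-spec v (drop (suc a) Y))
        nsv≡ : nsv Y (suc a) ≡ suc a + k
        nsv≡ = nsv-firstLess Y a i≤|Y|
        forth : LminAtStart (Y !_) (suc a) b → b < nsv Y (suc a)
        forth L with b <? nsv Y (suc a)
        ... | yes b<nsv = b<nsv
        ... | no b≮nsv = contradiction (subst (_⊏ v) (!-drop (suc a) Y 1≤k) (found k≤))
                           (L (suc a + k) (m<m+n (suc a) 1≤k) i+k≤b)
          where
            i+k≤b : suc a + k ≤ b
            i+k≤b = subst (_≤ b) nsv≡ (≮⇒≥ b≮nsv)
            k≤ : k ≤ length (drop (suc a) Y)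
            k≤ = subst (k ≤_) (sym (length-drop (suc a) Y))
                   (+-cancelˡ-≤ (suc a) k _ (subst (suc a + k ≤_) (sym (m+[n∸m]≡n i≤|Y|)) (≤-trans i+k≤b b≤|Y|)))
        back : b < nsv Y (suc a) → LminAtStart (Y !_) (suc a) b
        back b<nsv z i<z z≤b with m≤n⇒∃[o]m+o≡n (<⇒≤ i<z)
        ... | j , refl = subst (λ u → ¬ (u ⊏ v)) (!-drop (suc a) Y 1≤j)
                           (before j 1≤j (+-cancelˡ-< (suc a) j k (subst (suc a + j <_) nsv≡ (≤-<-trans z≤b b<nsv))))
          where 1≤j = +-cancelˡ-≤ (suc a) 1 j (subst (_≤ suc a + j) (+-comm 1 (suc a)) i<z)

    LeftmostMinAt⇒LminAtEnd : ∀ S {A B} → A < B → LeftmostMinAt S A B B → LminAtEnd (S !_) (suc A) B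
    LeftmostMinAt⇒LminAtEnd S {A} {B} A<B A+l≡B with frag S A B in frag≡
    ... | [] = contradiction (subst (A <_) (sym A+l≡B) A<B) (<-irrefl (sym (+-identityʳ A)))
    ... | x ∷ xs = subst₂ (LminAtEnd (S !_)) (+-comm A 1) A+l≡B
                     (to (LminAtEnd-shift (S !_) A) (LminAtEnd-cong (s≤s z≤n) frag≗S (LminAt.end (proj₂ (lmin-spec x xs)))))
      where
        l = suc (proj₁ (lmin x xs))
        frag≗S : AgreeOn ((x ∷ xs) !_) ((S !_) ∘ (A +_)) 1 l
        frag≗S z 1≤z z≤l = begin
          (x ∷ xs) ! z            ≡⟨ cong (_! z) frag≡ ⟨
          frag S A B ! z          ≡⟨ !-take (B ∸ A) (drop A S) (subst (z ≤_) l≡B∸A z≤l) ⟩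
          drop A S ! z            ≡⟨ !-drop A S 1≤z ⟩
          S ! (A + z)             ∎
          where
            open ≡-Reasoning
            l≡B∸A : l ≡ B ∸ A
            l≡B∸A = trans (sym (m+n∸m≡n A l)) (cong (_∸ A) A+l≡B)

    -- Substitutions

    opaque
      substAt : ℕ → Carrier → Subst → Carrier
      substAt m z (q , v) with q ≟ m
      ... | yes _ = v
      ... | no _ = z

      substAt-≢ : ∀ {m z q v} → q ≢ m → substAt m z (q , v) ≡ z
      substAt-≢ {m} {q = q} q≢m with q ≟ m
      ... | yes q≡m = contradiction q≡m q≢m
      ... | no _ = refl

      substAt-≡ : ∀ {m z v} → substAt m z (m , v) ≡ v
      substAt-≡ {m} with m ≟ m
      ... | yes _ = refl
      ... | no m≢m = contradiction refl m≢m

      substAt-suc : ∀ {m z q v} → substAt (suc m) z (suc q , v) ≡ substAt m z (q , v)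
      substAt-suc {m} {z} {q} {v} with q ≟ m
      ... | yes refl = substAt-≡ {suc m} {z} {v}
      ... | no q≢m = substAt-≢ (q≢m ∘ suc-injective)

    applyAt : ℕ → Carrier → List Subst → Carrier
    applyAt m = foldl (substAt m)

    length-set : ∀ Z q v → length (set Z q v) ≡ length Z
    length-set [] q v = refl
    length-set (x ∷ xs) zero v = refl
    length-set (x ∷ xs) (suc zero) v = refl
    length-set (x ∷ xs) (suc (suc j)) v = cong suc (length-set xs (suc j) v)

    !-set : ∀ Z q v {m} → 1 ≤ m → m ≤ length Z → set Z q v ! m ≡ substAt m (Z ! m) (q , v)
    !-set (x ∷ xs) zero v {suc m} _ _ = sym (substAt-≢ λ ())
    !-set (x ∷ xs) (suc zero) v {suc zero} _ _ = sym substAt-≡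
    !-set (x ∷ xs) (suc zero) v {suc (suc m)} _ _ = sym (substAt-≢ λ ())
    !-set (x ∷ xs) (suc (suc j)) v {suc zero} _ _ = sym (substAt-≢ λ ())
    !-set (x ∷ xs) (suc (suc j)) v {suc (suc m)} _ (s≤s m<) = trans (!-set xs (suc j) v (s≤s z≤n) m<) (sym substAt-suc)

    length-apply : ∀ Z ss → length (apply Z ss) ≡ length Z
    length-apply Z [] = refl
    length-apply Z ((q , v) ∷ ss) = trans (length-apply (set Z q v) ss) (length-set Z q v)

    !-apply : ∀ Z ss {m} → 1 ≤ m → m ≤ length Z → apply Z ss ! m ≡ applyAt m (Z ! m) ss
    !-apply Z [] _ _ = refl
    !-apply Z ((q , v) ∷ ss) {m} 1≤m m≤|Z| =
      trans (!-apply (set Z q v) ss 1≤m (subst (m ≤_) (sym (length-set Z q v)) m≤|Z|))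
            (cong (λ u → applyAt m u ss) (!-set Z q v 1≤m m≤|Z|))

    applyAt-untouched : ∀ {m z} ss → m ∉ map proj₁ ss → applyAt m z ss ≡ z
    applyAt-untouched [] _ = refl
    applyAt-untouched {m} {z} ((q , v) ∷ ss) m∉ =
      trans (cong (λ u → applyAt m u ss) (substAt-≢ (λ q≡m → m∉ (here (sym q≡m))))) (applyAt-untouched ss (m∉ ∘ there))

    module _ {P : ℕ → Set} (P? : Decidable P) where

      applyAt-filter-kept : ∀ {m z} ss → P m → applyAt m z (filter (P? ∘ proj₁) ss) ≡ applyAt m z ss
      applyAt-filter-kept [] _ = refl
      applyAt-filter-kept ((q , v) ∷ ss) Pm with P? q
      ... | yes _ = applyAt-filter-kept ss Pm
      ... | no ¬Pq = trans (applyAt-filter-kept ss Pm)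
                           (cong (λ u → applyAt _ u ss) (sym (substAt-≢ (λ { refl → ¬Pq Pm }))))

      applyAt-filter-dropped : ∀ {m z} ss → ¬ P m → applyAt m z (filter (P? ∘ proj₁) ss) ≡ z
      applyAt-filter-dropped [] _ = refl
      applyAt-filter-dropped {m} {z} ((q , v) ∷ ss) ¬Pm with P? q
      ... | yes Pq = trans (cong (λ u → applyAt m u (filter (P? ∘ proj₁) ss)) (substAt-≢ (λ { refl → ¬Pm Pq })))
                           (applyAt-filter-dropped ss ¬Pm)
      ... | no _ = applyAt-filter-dropped ss ¬Pm

    dropBlock : ℕ → ℕ → List Subst → List Subst
    dropBlock ci cj = filter (outsideBlock? ci cj ∘ proj₁)

    dropBlock-< : ∀ {ci cj} ss {s} → s ∈ ss → InBlock ci cj (proj₁ s) → length (dropBlock ci cj ss) < length ss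
    dropBlock-< ss s∈ss s-in = filter-notAll (outsideBlock? _ _ ∘ proj₁) ss (Any.map (λ { refl s-out → s-out s-in }) s∈ss)

    apply-dropBlock : ∀ X ss ci cj {z} → 1 ≤ z → z ≤ length X →
                      apply X (dropBlock ci cj ss) ! z ≡ splice ci cj (X !_) (apply X ss !_) z
    apply-dropBlock X ss ci cj {z} 1≤z z≤|X| with inBlock? ci cj z
    ... | yes z∈ = begin
      apply X (dropBlock ci cj ss) ! z       ≡⟨ !-apply X (dropBlock ci cj ss) 1≤z z≤|X| ⟩
      applyAt z (X ! z) (dropBlock ci cj ss) ≡⟨ applyAt-filter-dropped (outsideBlock? ci cj) ss (λ z∉ → z∉ z∈) ⟩
      X ! z                                  ≡⟨ splice-in z∈ ⟨
      splice ci cj (X !_) (apply X ss !_) z  ∎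
      where open ≡-Reasoning
    ... | no z∉ = begin
      apply X (dropBlock ci cj ss) ! z       ≡⟨ !-apply X (dropBlock ci cj ss) 1≤z z≤|X| ⟩
      applyAt z (X ! z) (dropBlock ci cj ss) ≡⟨ applyAt-filter-kept (outsideBlock? ci cj) ss z∉ ⟩
      applyAt z (X ! z) ss                   ≡⟨ !-apply X ss 1≤z z≤|X| ⟨
      apply X ss ! z                         ≡⟨ splice-out z∉ ⟨
      splice ci cj (X !_) (apply X ss !_) z  ∎
      where open ≡-Reasoning

    restore-block : ∀ {X Y ss A ci cj} → A < ci → ci < cj → cj ≤ length X → Transforms X Y ss →
                    CTEquivOn (X !_) (Y !_) (suc A) cj →
                    LminAtEnd (X !_) (suc A) cj → LminAtEnd (Y !_) (suc A) ci → LminAtEnd (Y !_) (suc A) cj →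
                    (∀ m → 1 ≤ m → m ≤ A → LminAtStart (Y !_) m ci → LminAtStart (Y !_) m cj) →
                    ci ∉ map proj₁ ss → cj ∉ map proj₁ ss →
                    Transforms X Y (dropBlock ci cj ss)
    restore-block {X} {Y} {ss} {A} {ci} {cj} A<ci ci<cj cj≤|X| (valid , X′≈Y) x≈y x-end-cj y-end-ci y-end-cj y-extend ci∉ cj∉ =
      filter⁺ (outsideBlock? ci cj ∘ proj₁) valid ,
      CTEquivOn⇒≈CT (trans |X″|≡|X| |X|≡|Y|)
        (subst (CTEquivOn _ _ 1) (sym |X″|≡|X|)
          (CTEquivOn-cong (λ z 1≤z z≤|X| → sym (apply-dropBlock X ss ci cj 1≤z z≤|X|)) (λ _ _ _ → refl) splice-CTEquivOn))
      where
        X′ = apply X ss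
        |X″|≡|X| : length (apply X (dropBlock ci cj ss)) ≡ length X
        |X″|≡|X| = length-apply X (dropBlock ci cj ss)
        |X|≡|Y| : length X ≡ length Y
        |X|≡|Y| = trans (sym (length-apply X ss)) (proj₁ (≈CT⇒CTEquivOn X′≈Y))
        x′≈y : CTEquivOn (X′ !_) (Y !_) 1 (length X)
        x′≈y = subst (CTEquivOn _ _ 1) (length-apply X ss) (proj₂ (≈CT⇒CTEquivOn X′≈Y))
        untouched : ∀ {m} → 1 ≤ m → m ≤ length X → m ∉ map proj₁ ss → X′ ! m ≡ X ! m
        untouched 1≤m m≤|X| m∉ = trans (!-apply X ss 1≤m m≤|X|) (applyAt-untouched ss m∉)
        1≤ci : 1 ≤ ci
        1≤ci = ≤-trans (s≤s z≤n) A<ci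
        open Splice (X !_) (X′ !_) (Y !_) A<ci ci<cj cj≤|X| x′≈y x≈y x-end-cj y-end-ci y-end-cj y-extend
                    (untouched 1≤ci (≤-trans (<⇒≤ ci<cj) cj≤|X|) ci∉) (untouched (≤-trans 1≤ci (<⇒≤ ci<cj)) cj≤|X| cj∉)

    ≈CT-infix⇒CTEquivOn : ∀ X₁ U X₂ Y₁ V Y₂ → length X₁ ≡ length Y₁ → U ≈CT V →
                          CTEquivOn ((X₁ ++ U ++ X₂) !_) ((Y₁ ++ V ++ Y₂) !_) (suc (length X₁)) (length X₁ + length U)
    ≈CT-infix⇒CTEquivOn X₁ U X₂ Y₁ V Y₂ |X₁|≡|Y₁| U≈V =
      subst (λ lo → CTEquivOn ((X₁ ++ U ++ X₂) !_) ((Y₁ ++ V ++ Y₂) !_) lo (length X₁ + length U)) (+-comm (length X₁) 1)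
        (CTEquivOn-shift ((X₁ ++ U ++ X₂) !_) ((Y₁ ++ V ++ Y₂) !_) (length X₁)
          (CTEquivOn-cong X≗U Y≗V (proj₂ (≈CT⇒CTEquivOn U≈V))))
      where
        |U|≡|V| : length U ≡ length V
        |U|≡|V| = proj₁ (≈CT⇒CTEquivOn U≈V)
        X≗U : AgreeOn (U !_) (λ z → (X₁ ++ U ++ X₂) ! (length X₁ + z)) 1 (length U)
        X≗U z 1≤z z≤|U| = sym (trans (!-++ʳ X₁ (U ++ X₂) 1≤z) (!-++ˡ U X₂ z≤|U|))
        Y≗V : AgreeOn (V !_) (λ z → (Y₁ ++ V ++ Y₂) ! (length X₁ + z)) 1 (length U)
        Y≗V z 1≤z z≤|U| = sym (trans (cong (λ a → (Y₁ ++ V ++ Y₂) ! (a + z)) |X₁|≡|Y₁|)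
                                     (trans (!-++ʳ Y₁ (V ++ Y₂) 1≤z) (!-++ˡ V Y₂ (subst (z ≤_) |U|≡|V| z≤|U|))))

    LminAtStart-extend : ∀ Y {m ci cj lo hi} → 1 ≤ m → m ≤ length Y → ci ≤ cj → cj ≤ length Y →
                         ¬ (lo ≤ nsv Y m × nsv Y m ≤ hi) → lo ≤ suc ci → cj ≤ hi →
                         LminAtStart (Y !_) m ci → LminAtStart (Y !_) m cj
    LminAtStart-extend Y 1≤m m≤|Y| ci≤cj cj≤|Y| no-nsv lo≤ci+1 cj≤hi L = from (LminAtStart⇔<nsv Y 1≤m m≤|Y| cj≤|Y|)
      (≰⇒> λ nsv≤cj → no-nsv (≤-trans lo≤ci+1 ci<nsv , ≤-trans nsv≤cj cj≤hi))
      where ci<nsv = to (LminAtStart⇔<nsv Y 1≤m m≤|Y| (≤-trans ci≤cj cj≤|Y|)) L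


lemma37 : ∀ {a ℓ₁ ℓ₂} (O : StrictTotalOrder a ℓ₁ ℓ₂) →
  let open Strings O in
  (p r k : ℕ) → 1 ≤ p → 1 ≤ r → 1 ≤ k →
  (X₁ U X₂ Y₁ V Y₂ : Str) →
  let X = X₁ ++ U ++ X₂
      Y = Y₁ ++ V ++ Y₂
      c = λ (i : ℕ) → length X₁ + i * p
  in
  length X₁ ≡ length Y₁ → length X₂ ≡ length Y₂ →
  length U ≡ r * p → length V ≡ r * p → 2 * k + 1 ≤ r →
  U ≈CT V →
  (∀ i → 1 ≤ i → i ≤ length Y₁ →
    ¬ (length Y₁ + p + 1 ≤ nsv Y i × nsv Y i ≤ length Y₁ + length V)) →
  (∀ i → 1 ≤ i → i ≤ r →
    LeftmostMinAt X (c 1 ∸ p) (c i) (c i) × LeftmostMinAt Y (c 1 ∸ p) (c i) (c i)) →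
  (d : ℕ) → IsCHd X Y d → d ≤ k →
  (ss : List Subst) → Transforms X Y ss → length ss ≡ d →
  All (λ s → ¬ (c (k + 1) ≤ proj₁ s × proj₁ s ≤ c (r ∸ k))) ss
lemma37 O p r k 1≤p _ _ X₁ U X₂ Y₁ V Y₂ |X₁|≡|Y₁| _ |U|≡rp |V|≡rp 2k+1≤r U≈V no-nsv-in-V lmins
        d chd d≤k ss tr |ss|≡d =
  All.tabulate core-untouched
  where
    open Strings O
    open Sequences O
    open Anchors (length X₁) p 1≤p
    A = length X₁
    X = X₁ ++ U ++ X₂
    Y = Y₁ ++ V ++ Y₂
    |ps|≤k : length (map proj₁ ss) ≤ k
    |ps|≤k = subst (_≤ k) (sym (trans (length-map proj₁ ss) |ss|≡d)) d≤k
    k≤r : k ≤ r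
    k≤r = ≤-trans (≤-trans (m≤m+n k (k + 0)) (m≤m+n _ 1)) 2k+1≤r
    c≤A+|U| : ∀ {i} → i ≤ r → c i ≤ A + length U
    c≤A+|U| {i} i≤r = subst (λ u → c i ≤ A + u) (sym |U|≡rp) (c-mono i≤r)
    A+|U|≡|Y₁|+|V| : A + length U ≡ length Y₁ + length V
    A+|U|≡|Y₁|+|V| = cong₂ _+_ |X₁|≡|Y₁| (trans |U|≡rp (sym |V|≡rp))
    core-untouched : ∀ {s} → s ∈ ss → ¬ (c (k + 1) ≤ proj₁ s × proj₁ s ≤ c (r ∸ k))
    core-untouched {q , v} s∈ss (c[k+1]≤q , q≤c[r-k])
      with anchor-∉-below k (map proj₁ ss) |ps|≤k (∈-map⁺ proj₁ s∈ss) c[k+1]≤q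
         | anchor-∉-above (r ∸ k) k (map proj₁ ss) |ps|≤k (∈-map⁺ proj₁ s∈ss) q≤c[r-k]
    ... | i , 1≤i , i≤k , ci<q , ci∉ | j₀ , 1≤j₀ , j₀≤k , q<cj , cj∉ = <⇒≱ shorter (proj₂ chd ss′ still-transforms)
      where
        -- the substituted character v serves as the out-of-range filler, which is never read
        open Indexing v
        j = r ∸ k + j₀
        ss′ = dropBlock (c i) (c j) ss
        shorter : length ss′ < d
        shorter = subst (length ss′ <_) |ss|≡d (dropBlock-< ss s∈ss (ci<q , <⇒≤ q<cj))
        1≤j : 1 ≤ j
        1≤j = ≤-trans 1≤j₀ (m≤n+m j₀ (r ∸ k))
        j≤r : j ≤ r
        j≤r = ≤-trans (+-monoʳ-≤ (r ∸ k) j₀≤k) (≤-reflexive (m∸n+n≡m k≤r))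
        ends : ∀ {i} → 1 ≤ i → i ≤ r → LminAtEnd (X !_) (suc A) (c i) × LminAtEnd (Y !_) (suc A) (c i)
        ends {i} 1≤i i≤r =
          LeftmostMinAt⇒LminAtEnd X (A<c 1≤i) (subst (λ a → LeftmostMinAt X a (c i) (c i)) c1∸p≡A (proj₁ (lmins i 1≤i i≤r))) ,
          LeftmostMinAt⇒LminAtEnd Y (A<c 1≤i) (subst (λ a → LeftmostMinAt Y a (c i) (c i)) c1∸p≡A (proj₂ (lmins i 1≤i i≤r)))
        y-extend : ∀ m → 1 ≤ m → m ≤ A → LminAtStart (Y !_) m (c i) → LminAtStart (Y !_) m (c j)
        y-extend m 1≤m m≤A = LminAtStart-extend Y 1≤m (≤-trans m≤|Y₁| (≤-trans (m≤m+n _ _) (length-infix-≤ Y₁ V Y₂)))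
          (<⇒≤ (<-trans ci<q q<cj)) (≤-trans cj≤|Y₁|+|V| (length-infix-≤ Y₁ V Y₂)) (no-nsv-in-V m 1≤m m≤|Y₁|)
          (subst (λ a → a + p + 1 ≤ suc (c i)) |X₁|≡|Y₁| (≤-trans (≤-reflexive (+-comm (A + p) 1)) (s≤s (A+p≤c 1≤i))))
          cj≤|Y₁|+|V|
          where
            m≤|Y₁| : m ≤ length Y₁
            m≤|Y₁| = subst (m ≤_) |X₁|≡|Y₁| m≤A
            cj≤|Y₁|+|V| : c j ≤ length Y₁ + length V
            cj≤|Y₁|+|V| = subst (c j ≤_) A+|U|≡|Y₁|+|V| (c≤A+|U| j≤r)
        still-transforms : Transforms X Y ss′
        still-transforms = restore-block (A<c 1≤i) (<-trans ci<q q<cj) (≤-trans (c≤A+|U| j≤r) (length-infix-≤ X₁ U X₂)) tr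
          (CTEquivOn-shrink ≤-refl (c≤A+|U| j≤r) (≈CT-infix⇒CTEquivOn X₁ U X₂ Y₁ V Y₂ |X₁|≡|Y₁| U≈V))
          (proj₁ (ends 1≤j j≤r)) (proj₂ (ends 1≤i (≤-trans i≤k k≤r))) (proj₂ (ends 1≤j j≤r)) y-extend ci∉ cj∉
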